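{- Consider any instance of the Online Budgeted Repeated Matching (OBRM) problem (defined in the context) with $w(i,j)\le C_i$ for all edges. Run RANDOMONLINEGREEDY (defined in the context), and let $B(T)=\bigcup_{i\in I}B_i(T)$ be the set of all edges selected by its GREEDY calls. Let $A^*(T)$ be an optimal (maximum-weight) feasible set of edges for the instance. Then $W(B(T))\ge \tfrac13\, W(A^*(T))$.
   Context: OBRM problem: there is a set $I=\{1,\dots,n\}$ of servers, server $i$ having capacity $C_i>0$. At each time step $t\in\{1,\dots,T\}$ a set of jobs $J(t)$ and a set $E(t)$ of edges between servers $I$ and jobs $J(t)$ are revealed, forming the bipartite graph $G(t)=(I\cup J(t),E(t))$; each edge $e=(i,j)$ has a nonnegative weight $w(e)=w(i,j)$. For a set of edges $F$, $W(F)=\sum_{e\in F}w(e)$. A set of edges $F$ is feasible if (i) for each $t$ the edges of $F$ in $E(t)$ form a matching, and (ii) for each server $i$ the total weight of edges of $F$ incident to $i$ is at most $C_i$. Subroutine GREEDY$(G,S)$: given a weighted bipartite graph $G$ and a set $S$ of servers, start with $M=\emptyset$, scan the edges of $G$ in non-increasing order of weight, and add edge $(i,j)$ to $M$ if $i\in S$ and $M\cup\{(i,j)\}$ is still a matching. Return $M$. RANDOMONLINEGREEDY: before the input, for each server $i$ flip an independent fair coin $v_i\in\{0,1\}$. Initially $S=I$ and $A_i(0)=B_i(0)=\emptyset$ for all $i$. For $t=1,\dots,T$: set $M(t)=$GREEDY$(G(t),S)$; for each $e=(i,j)\in M(t)$: set $B_i(t)=B_i(t-1)\cup\{e\}$;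 if $W(B_i(t))>\tfrac12 C_i$ remove $i$ from $S$; if ($v_i=1$ and $w(i,j)>\tfrac12C_i$) or ($v_i=0$ and $w(i,j)\le \tfrac12 C_i$) then set $A_i(t)=A_i(t-1)\cup\{e\}$. (Sets not updated at step $t$ are carried over unchanged.)
   Formalization: The edge weights $w(i,j)$ and the capacities $C_i$ are rational numbers. -}

module Defs where

open import Data.Nat using (ℕ)
open import Data.Fin using (Fin; _≟_)
open import Data.Bool using (Bool; true; false; if_then_else_; _∧_; _∨_; not)
open import Data.List using (List; []; _∷_; _++_; [_]; foldl; foldr; map; allFin; filter)
open import Data.Bool.ListAction using (any)
open import Data.Product using (Σ; _×_; _,_; proj₁; proj₂)
open import Data.Sum using (_⊎_)
open import Data.Rational using (ℚ; 0ℚ; ½; _+_; _*_; _≤_; _<_)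
open import Data.Rational.Properties using (_≤?_; _<?_)
open import Relation.Nullary using (yes; no)
open import Relation.Nullary.Decidable using (⌊_⌋)
open import Relation.Binary.PropositionalEquality using (_≡_; refl)
open import Data.List.Membership.Propositional using (_∈_)
open import Data.List.Relation.Unary.All using (All)
open import Data.List.Relation.Unary.Unique.Propositional using (Unique)
open import Data.List.Relation.Unary.Linked using (Linked)
open import Data.List.Relation.Binary.Permutation.Propositional using (_↭_)

-- An OBRM instance: servers Fin n, time steps Fin T (t = 0..T-1 stands
-- for 1..T), at step t the jobs are Fin (jobs t) and the edge set E(t)
-- is the list E t (required to be duplicate-free, see WellFormed), with
-- weight w t i j on edge (i , j).

record Instance (n T : ℕ) : Set where
  field
    C    : Fin n → ℚ
    jobs : Fin T → ℕ
    E    : (t : Fin T) → List (Fin n × Fin (jobs t))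
    w    : (t : Fin T) → Fin n → Fin (jobs t) → ℚ

module _ {n T : ℕ} (I : Instance n T) where
  open Instance I

  WellFormed : Set
  WellFormed = (∀ i → 0ℚ < C i)
             × (∀ t → Unique (E t))
             × (∀ t i j → (i , j) ∈ E t → 0ℚ ≤ w t i j)

  EdgeSet : Set
  EdgeSet = (t : Fin T) → List (Fin n × Fin (jobs t))

  sumℚ : List ℚ → ℚ
  sumℚ = foldr _+_ 0ℚ

  Wt : (t : Fin T) → List (Fin n × Fin (jobs t)) → ℚ
  Wt t F = sumℚ (map (λ e → w t (proj₁ e) (proj₂ e)) F)

  W : EdgeSet → ℚ
  W F = sumℚ (map (λ t → Wt t (F t)) (allFin T))

  atServer : Fin n → EdgeSet → EdgeSet
  atServer i F t = filter (λ e → proj₁ e ≟ i) (F t)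

  load : Fin n → EdgeSet → ℚ
  load i F = W (atServer i F)

  IsMatching : {m : ℕ} → List (Fin n × Fin m) → Set
  IsMatching L = ∀ {e e'} → e ∈ L → e' ∈ L →
                 (proj₁ e ≡ proj₁ e' ⊎ proj₂ e ≡ proj₂ e') → e ≡ e'

  Feasible : EdgeSet → Set
  Feasible F = (∀ t → All (_∈ E t) (F t))
             × (∀ t → Unique (F t))
             × (∀ t → IsMatching (F t))
             × (∀ i → load i F ≤ C i)

  Optimal : EdgeSet → Set
  Optimal A = Feasible A × (∀ F → Feasible F → W F ≤ W A)

  ScanOrder : (t : Fin T) → List (Fin n × Fin (jobs t)) → Set
  ScanOrder t σ = (σ ↭ E t)
                × Linked (λ e e' → w t (proj₁ e') (proj₂ e') ≤ w t (proj₁ e) (proj₂ e)) σ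

greedy : {n m : ℕ} → (Fin n → Bool) → List (Fin n × Fin m) →
         List (Fin n × Fin m) → List (Fin n × Fin m)
greedy S M [] = M
greedy S M ((i , j) ∷ es) =
  if S i ∧ not (any (λ e → ⌊ proj₁ e ≟ i ⌋) M) ∧ not (any (λ e → ⌊ proj₂ e ≟ j ⌋) M)
  then greedy S (M ++ [ (i , j) ]) es
  else greedy S M es

module _ {n T : ℕ} (I : Instance n T) where
  open Instance I

  record State : Set where
    field
      S : Fin n → Bool
      A : EdgeSet I             -- A(t) = ⋃_i A_i(t)  (A_i = atServer i A)
      B : EdgeSet I             -- B(t) = ⋃_i B_i(t)  (B_i = atServer i B)

  addAt : (t : Fin T) → Fin n × Fin (jobs t) → EdgeSet I → EdgeSet I
  addAt t e F t' with t ≟ t'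
  ... | yes refl = F t' ++ [ e ]
  ... | no _     = F t'

  removeServer : Fin n → (Fin n → Bool) → (Fin n → Bool)
  removeServer i S k = if ⌊ k ≟ i ⌋ then false else S k

  initial : State
  initial = record { S = λ _ → true ; A = λ _ → [] ; B = λ _ → [] }

  processEdge : (v : Fin n → Bool) (t : Fin T) → State → Fin n × Fin (jobs t) → State
  processEdge v t st (i , j) = record
    { S = if ⌊ ½ * C i <? load I i B' ⌋ then removeServer i (State.S st) else State.S st
    ; A = if (v i ∧ ⌊ ½ * C i <? w t i j ⌋) ∨ (not (v i) ∧ ⌊ w t i j ≤? ½ * C i ⌋)
          then addAt t (i , j) (State.A st) else State.A st
    ; B = B'
    }
    where
    B' : EdgeSet I
    B' = addAt t (i , j) (State.B st)

  step : (σ : (t : Fin T) → List (Fin n × Fin (jobs t))) (v : Fin n → Bool) →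
         State → Fin T → State
  step σ v st t = foldl (processEdge v t) st (greedy (State.S st) [] (σ t))

  -- RANDOMONLINEGREEDY with coin outcomes v and GREEDY scan orders σ;
  -- returns the state after time step T.
  run : (σ : (t : Fin T) → List (Fin n × Fin (jobs t))) (v : Fin n → Bool) → State
  run σ v = foldl (step σ v) initial (allFin T)

-- Let O be the set of servers still in S when the run ends. An edge (i , j) of a feasible F with
-- i ∈ O was scanned by GREEDY at its time step while i was in S, so it was rejected only because a
-- heavier selected edge shares i or j. Since F(t) is a matching, each selected edge is charged at
-- most once through its server and once through its job: W(F at O) ≤ W(B at O) + W(B). A server
-- outside O was removed because W(B_i) > C_i / 2 ≥ W(F_i) / 2, so W(F off O) ≤ 2 W(B off O).
-- Adding up, W(F) ≤ 3 W(B) for every feasible F.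

module Submission where

open import Defs
open import Data.Nat using (ℕ)
open import Data.Fin using (Fin)
open import Data.Bool using (Bool)
open import Data.List using (List)
open import Data.Product using (_×_; _,_)
open import Data.Integer using (+_)
open import Data.Rational using (_/_; _*_; _≤_)
open import Data.List.Membership.Propositional using (_∈_)

open import Algebra.Bundles using (CommutativeMonoid)
open import Data.Bool using (true; false; T; _∧_; not; if_then_else_)
open import Data.Bool.ListAction using (any)
open import Data.Bool.Properties using (T-≡; ¬-not)
import Data.Bool.Properties as Bool
open import Data.Fin using (_≟_)
open import Data.List using ([]; _∷_; _++_; [_]; foldr; foldl; map; filter; allFin)
open import Data.List.Properties
  using (++-assoc; ++-identityʳ; map-∘; filter-++; filter-accept; filter-reject; filter-≐)
open import Data.List.Membership.Propositional using (_∉_; find)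
open import Data.List.Membership.Propositional.Properties
  using (∈-++⁺ʳ; ∈-++⁻; ∈-filter⁺; ∈-filter⁻; ∈-allFin)
open import Data.List.Relation.Binary.Permutation.Propositional using (↭-sym)
open import Data.List.Relation.Binary.Permutation.Propositional.Properties using (∈-resp-↭)
open import Data.List.Relation.Binary.Sublist.Propositional
  using ([]; _∷_; _∷ʳ_; from∈) renaming (_⊆_ to _⊑_)
open import Data.List.Relation.Binary.Sublist.Propositional.Properties using (filter-⊆)
open import Data.List.Relation.Binary.Subset.Propositional using (_⊆_)
open import Data.List.Relation.Binary.Subset.Propositional.Properties
  using (⊆-refl; ⊆-trans; xs⊆xs++ys; xs⊆x∷xs; ++⁺ʳ)
import Data.List.Relation.Unary.All as All
open import Data.List.Relation.Unary.All.Properties using (All¬⇒¬Any)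
import Data.List.Relation.Unary.All.Properties as All
open import Data.List.Relation.Unary.AllPairs using (AllPairs; []; _∷_)
open import Data.List.Relation.Unary.Any using (here; there)
open import Data.List.Relation.Unary.Any.Properties using (any⁻)
open import Data.List.Relation.Unary.Linked.Properties using (Linked⇒AllPairs)
open import Data.List.Relation.Unary.Unique.Propositional using (Unique)
import Data.List.Relation.Unary.Unique.Propositional.Properties as Unique
open import Data.Product using (∃; proj₁; proj₂)
open import Data.Rational using (ℚ; 0ℚ; ½; _+_; _<_)
open import Data.Rational.Properties
  using ( ≤-refl; ≤-trans; ≤-reflexive; <⇒≤; <-≤-trans; _<?_; +-assoc; +-identityˡ; +-identityʳ
        ; +-mono-≤; +-monoˡ-≤; +-monoʳ-≤; *-identityˡ; *-distribʳ-+; *-monoˡ-≤-nonNeg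
        ; +-0-commutativeMonoid; module ≤-Reasoning)
open import Algebra.Properties.CommutativeSemigroup
  (CommutativeMonoid.commutativeSemigroup +-0-commutativeMonoid) using (interchange; x∙yz≈y∙xz)
open import Data.Rational.Solver using (module +-*-Solver)
open import Data.Sum using (_⊎_; inj₁; inj₂)
open import Function using (_∘_; id)
open import Function.Bundles using (Equivalence)
open import Relation.Binary.Definitions using (DecidableEquality)
open import Relation.Binary.PropositionalEquality
  using (_≡_; _≢_; refl; sym; trans; cong; cong₂; subst; module ≡-Reasoning)
open import Relation.Nullary using (Dec; yes; no; contradiction)
open import Relation.Nullary.Decidable using (⌊_⌋; toWitness)
open import Relation.Unary using (Decidable; _≐_)
open import Relation.Unary.Properties using (∁?)

p≤p+q : ∀ p {q} → 0ℚ ≤ q → p ≤ p + q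
p≤p+q p {q} 0≤q = begin
  p       ≡⟨ sym (+-identityʳ p) ⟩
  p + 0ℚ  ≤⟨ +-monoʳ-≤ p 0≤q ⟩
  p + q   ∎
  where open ≤-Reasoning

p≤q+p : ∀ p {q} → 0ℚ ≤ q → p ≤ q + p
p≤q+p p {q} 0≤q = begin
  p       ≡⟨ sym (+-identityˡ p) ⟩
  0ℚ + p  ≤⟨ +-monoˡ-≤ p 0≤q ⟩
  q + p   ∎
  where open ≤-Reasoning

½*p<q⇒p≤q+q : ∀ {p q} → ½ * p < q → p ≤ q + q
½*p<q⇒p≤q+q {p} {q} ½p<q = begin
  p              ≡⟨ sym (*-identityˡ p) ⟩
  (½ + ½) * p    ≡⟨ *-distribʳ-+ p ½ ½ ⟩
  ½ * p + ½ * p  ≤⟨ +-mono-≤ (<⇒≤ ½p<q) (<⇒≤ ½p<q) ⟩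
  q + q          ∎
  where open ≤-Reasoning

-- Definitionally equal to sumℚ ∘ map, so that Wt, W and load of Defs unfold to iterated ∑.
∑ : {A : Set} → (A → ℚ) → List A → ℚ
∑ f xs = foldr _+_ 0ℚ (map f xs)

module _ {A : Set} where

  ∑-cong : {f g : A → ℚ} (xs : List A) → (∀ {x} → x ∈ xs → f x ≡ g x) → ∑ f xs ≡ ∑ g xs
  ∑-cong []       f≡g = refl
  ∑-cong (x ∷ xs) f≡g = cong₂ _+_ (f≡g (here refl)) (∑-cong xs (f≡g ∘ there))

  ∑-zero : {f : A → ℚ} (xs : List A) → (∀ {x} → x ∈ xs → f x ≡ 0ℚ) → ∑ f xs ≡ 0ℚ
  ∑-zero []       f≡0 = refl
  ∑-zero (x ∷ xs) f≡0 = cong₂ _+_ (f≡0 (here refl)) (∑-zero xs (f≡0 ∘ there))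

  ∑-mono : {f g : A → ℚ} (xs : List A) → (∀ {x} → x ∈ xs → f x ≤ g x) → ∑ f xs ≤ ∑ g xs
  ∑-mono []       f≤g = ≤-refl
  ∑-mono (x ∷ xs) f≤g = +-mono-≤ (f≤g (here refl)) (∑-mono xs (f≤g ∘ there))

  ∑-nonNeg : {f : A → ℚ} (xs : List A) → (∀ {x} → x ∈ xs → 0ℚ ≤ f x) → 0ℚ ≤ ∑ f xs
  ∑-nonNeg xs 0≤f = ≤-trans (≤-reflexive (sym (∑-zero xs (λ _ → refl)))) (∑-mono xs 0≤f)

  ∑-+ : (f g : A → ℚ) (xs : List A) → ∑ (λ x → f x + g x) xs ≡ ∑ f xs + ∑ g xs
  ∑-+ f g []       = refl
  ∑-+ f g (x ∷ xs) =
    trans (cong (_+_ (f x + g x)) (∑-+ f g xs)) (interchange (f x) (g x) (∑ f xs) (∑ g xs))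

  ∑-++ : (f : A → ℚ) (xs ys : List A) → ∑ f (xs ++ ys) ≡ ∑ f xs + ∑ f ys
  ∑-++ f []       ys = sym (+-identityˡ (∑ f ys))
  ∑-++ f (x ∷ xs) ys = trans (cong (_+_ (f x)) (∑-++ f xs ys)) (sym (+-assoc (f x) (∑ f xs) (∑ f ys)))

  ∑-++-≥ : (f : A → ℚ) (xs : List A) {ys : List A} → (∀ {y} → y ∈ ys → 0ℚ ≤ f y) →
           ∑ f xs ≤ ∑ f (xs ++ ys)
  ∑-++-≥ f xs {ys} 0≤f = begin
    ∑ f xs           ≤⟨ p≤p+q (∑ f xs) (∑-nonNeg ys 0≤f) ⟩
    ∑ f xs + ∑ f ys  ≡⟨ sym (∑-++ f xs ys) ⟩
    ∑ f (xs ++ ys)   ∎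
    where open ≤-Reasoning

  ∑-map : {B : Set} (f : B → ℚ) (g : A → B) (xs : List A) → ∑ f (map g xs) ≡ ∑ (f ∘ g) xs
  ∑-map f g xs = cong (foldr _+_ 0ℚ) (sym (map-∘ xs))

  ∑-mono-⊑ : {f : A → ℚ} {xs ys : List A} → xs ⊑ ys → (∀ {y} → y ∈ ys → 0ℚ ≤ f y) → ∑ f xs ≤ ∑ f ys
  ∑-mono-⊑ []                               0≤f = ≤-refl
  ∑-mono-⊑ {f} {xs} {y ∷ ys} (y ∷ʳ xs⊑ys)   0≤f = begin
    ∑ f xs         ≡⟨ sym (+-identityˡ (∑ f xs)) ⟩
    0ℚ + ∑ f xs    ≤⟨ +-mono-≤ (0≤f (here refl)) (∑-mono-⊑ xs⊑ys (0≤f ∘ there)) ⟩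
    f y + ∑ f ys   ∎
    where open ≤-Reasoning
  ∑-mono-⊑ {f} {x ∷ _} (refl ∷ xs⊑ys) 0≤f = +-monoʳ-≤ (f x) (∑-mono-⊑ xs⊑ys (0≤f ∘ there))

  ∑-member : {f : A → ℚ} {x : A} {xs : List A} → (∀ {y} → y ∈ xs → 0ℚ ≤ f y) → x ∈ xs → f x ≤ ∑ f xs
  ∑-member {f} {x} {xs} 0≤f x∈xs = begin
    f x        ≡⟨ sym (+-identityʳ (f x)) ⟩
    ∑ f [ x ]  ≤⟨ ∑-mono-⊑ (from∈ x∈xs) 0≤f ⟩
    ∑ f xs     ∎
    where open ≤-Reasoning

  module _ {P : A → Set} (P? : Decidable P) where

    ∑-filter-∷ : (f : A → ℚ) (x : A) (xs : List A) →
                 ∑ f (filter P? (x ∷ xs)) ≡ ∑ f (filter P? [ x ]) + ∑ f (filter P? xs)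
    ∑-filter-∷ f x xs =
      trans (cong (∑ f) (filter-++ P? [ x ] xs)) (∑-++ f (filter P? [ x ]) (filter P? xs))

    ∑-filter-partition : (f : A → ℚ) (xs : List A) →
                         ∑ f xs ≡ ∑ f (filter P? xs) + ∑ f (filter (∁? P?) xs)
    ∑-filter-partition f []       = refl
    ∑-filter-partition f (x ∷ xs) with P? x
    ... | yes _ = trans (cong (_+_ (f x)) (∑-filter-partition f xs))
                        (sym (+-assoc (f x) (∑ f (filter P? xs)) (∑ f (filter (∁? P?) xs))))
    ... | no  _ = trans (cong (_+_ (f x)) (∑-filter-partition f xs))
                        (x∙yz≈y∙xz (f x) (∑ f (filter P? xs)) (∑ f (filter (∁? P?) xs)))

∑-swap : {A B : Set} (f : A → B → ℚ) (xs : List A) (ys : List B) →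
         ∑ (λ x → ∑ (f x) ys) xs ≡ ∑ (λ y → ∑ (λ x → f x y) xs) ys
∑-swap f []       ys = sym (∑-zero ys (λ _ → refl))
∑-swap f (x ∷ xs) ys =
  trans (cong (_+_ (∑ (f x) ys)) (∑-swap f xs ys)) (sym (∑-+ (f x) (λ y → ∑ (λ x → f x y) xs) ys))

module _ {A K : Set} (_≟_ : DecidableEquality K) (κ : A → K) where

  open import Data.List.Membership.DecPropositional _≟_ using (_∈?_)

  fibre : K → List A → List A
  fibre k = filter (λ y → κ y ≟ k)

  module _ (h : A → ℚ) {ys : List A} (0≤h : ∀ {y} → y ∈ ys → 0ℚ ≤ h y) where

    ∑-fibre-nonNeg : (k : K) → 0ℚ ≤ ∑ h (fibre k ys)
    ∑-fibre-nonNeg k = ∑-nonNeg (fibre k ys) (0≤h ∘ proj₁ ∘ ∈-filter⁻ (λ y → κ y ≟ k))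

    ∈-fibre⇒≤∑ : {y : A} {k : K} → y ∈ ys → κ y ≡ k → h y ≤ ∑ h (fibre k ys)
    ∈-fibre⇒≤∑ {y} {k} y∈ys κy≡k =
      ∑-member (0≤h ∘ proj₁ ∘ ∈-filter⁻ (λ y′ → κ y′ ≟ k)) (∈-filter⁺ (λ y′ → κ y′ ≟ k) y∈ys κy≡k)

  private
    fibres-∉ : (h : A → ℚ) {y : A} {ks : List K} → κ y ∉ ks → ∑ (λ k → ∑ h (fibre k [ y ])) ks ≡ 0ℚ
    fibres-∉ h {y} {ks} κy∉ks =
      ∑-zero ks (λ {k} k∈ks → cong (∑ h) (filter-reject (λ y′ → κ y′ ≟ k) (λ { refl → κy∉ks k∈ks })))

    fibres-∈ : (h : A → ℚ) {y : A} {ks : List K} → Unique ks → κ y ∈ ks →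
               ∑ (λ k → ∑ h (fibre k [ y ])) ks ≡ ∑ h [ y ]
    fibres-∈ h {y} {_ ∷ ks} (κy∉ks ∷ _) (here refl) = begin
      ∑ h (fibre (κ y) [ y ]) + ∑ (λ k → ∑ h (fibre k [ y ])) ks
        ≡⟨ cong₂ _+_ (cong (∑ h) (filter-accept (λ y′ → κ y′ ≟ κ y) refl))
                     (fibres-∉ h (All¬⇒¬Any κy∉ks)) ⟩
      ∑ h [ y ] + 0ℚ
        ≡⟨ +-identityʳ (∑ h [ y ]) ⟩
      ∑ h [ y ] ∎
      where open ≡-Reasoning
    fibres-∈ h {y} {k ∷ ks} (k∉ks ∷ ks!) (there κy∈ks) = begin
      ∑ h (fibre k [ y ]) + ∑ (λ k → ∑ h (fibre k [ y ])) ks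
        ≡⟨ cong₂ _+_ (cong (∑ h) (filter-reject (λ y′ → κ y′ ≟ k) (All.lookup k∉ks κy∈ks ∘ sym)))
                     (fibres-∈ h ks! κy∈ks) ⟩
      0ℚ + ∑ h [ y ]
        ≡⟨ +-identityˡ (∑ h [ y ]) ⟩
      ∑ h [ y ] ∎
      where open ≡-Reasoning

    fibres-singleton : (h : A → ℚ) (y : A) {ks : List K} → Unique ks →
                       ∑ (λ k → ∑ h (fibre k [ y ])) ks ≡ ∑ h (filter (λ y′ → κ y′ ∈? ks) [ y ])
    fibres-singleton h y {ks} ks! with κ y ∈? ks
    ... | yes κy∈ks = fibres-∈ h ks! κy∈ks
    ... | no  κy∉ks = fibres-∉ h κy∉ks

  ∑-fibres : (h : A → ℚ) {ks : List K} → Unique ks → (ys : List A) →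
             ∑ (λ k → ∑ h (fibre k ys)) ks ≡ ∑ h (filter (λ y → κ y ∈? ks) ys)
  ∑-fibres h {ks} ks! []       = ∑-zero ks (λ _ → refl)
  ∑-fibres h {ks} ks! (y ∷ ys) = begin
    ∑ (λ k → ∑ h (fibre k (y ∷ ys))) ks
      ≡⟨ ∑-cong ks (λ {k} _ → ∑-filter-∷ (λ y → κ y ≟ k) h y ys) ⟩
    ∑ (λ k → ∑ h (fibre k [ y ]) + ∑ h (fibre k ys)) ks
      ≡⟨ ∑-+ (λ k → ∑ h (fibre k [ y ])) (λ k → ∑ h (fibre k ys)) ks ⟩
    ∑ (λ k → ∑ h (fibre k [ y ])) ks + ∑ (λ k → ∑ h (fibre k ys)) ks
      ≡⟨ cong₂ _+_ (fibres-singleton h y ks!) (∑-fibres h ks! ys) ⟩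
    ∑ h (filter (λ y → κ y ∈? ks) [ y ]) + ∑ h (filter (λ y → κ y ∈? ks) ys)
      ≡⟨ sym (∑-filter-∷ (λ y → κ y ∈? ks) h y ys) ⟩
    ∑ h (filter (λ y → κ y ∈? ks) (y ∷ ys)) ∎
    where open ≡-Reasoning

  ∑-fibres-≤ : (h : A → ℚ) {ks : List K} → Unique ks → {ys : List A} → (∀ {y} → y ∈ ys → 0ℚ ≤ h y) →
               ∑ (λ k → ∑ h (fibre k ys)) ks ≤ ∑ h ys
  ∑-fibres-≤ h {ks} ks! {ys} 0≤h = begin
    ∑ (λ k → ∑ h (fibre k ys)) ks      ≡⟨ ∑-fibres h ks! ys ⟩
    ∑ h (filter (λ y → κ y ∈? ks) ys)  ≤⟨ ∑-mono-⊑ (filter-⊆ (λ y → κ y ∈? ks) ys) 0≤h ⟩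
    ∑ h ys                             ∎
    where open ≤-Reasoning

module _ {A K₁ K₂ : Set} (_≟₁_ : DecidableEquality K₁) (_≟₂_ : DecidableEquality K₂)
         (κ₁ : A → K₁) (κ₂ : A → K₂) (h : A → ℚ) where

  ∑-≤-by-charging : {xs ys zs : List A} → Unique (map κ₁ xs) → Unique (map κ₂ xs) →
                    (∀ {y} → y ∈ ys → 0ℚ ≤ h y) → (∀ {z} → z ∈ zs → 0ℚ ≤ h z) →
                    (∀ {x} → x ∈ xs → ∃ λ y → (y ∈ ys × κ₁ y ≡ κ₁ x ⊎ y ∈ zs × κ₂ y ≡ κ₂ x) × h x ≤ h y) →
                    ∑ h xs ≤ ∑ h ys + ∑ h zs
  ∑-≤-by-charging {xs} {ys} {zs} κ₁! κ₂! 0≤h-ys 0≤h-zs charge = begin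
    ∑ h xs                               ≤⟨ ∑-mono xs (charged ∘ charge) ⟩
    ∑ (λ x → c₁ (κ₁ x) + c₂ (κ₂ x)) xs   ≡⟨ ∑-+ (c₁ ∘ κ₁) (c₂ ∘ κ₂) xs ⟩
    ∑ (c₁ ∘ κ₁) xs + ∑ (c₂ ∘ κ₂) xs      ≡⟨ sym (cong₂ _+_ (∑-map c₁ κ₁ xs) (∑-map c₂ κ₂ xs)) ⟩
    ∑ c₁ (map κ₁ xs) + ∑ c₂ (map κ₂ xs)  ≤⟨ +-mono-≤ (∑-fibres-≤ _≟₁_ κ₁ h κ₁! 0≤h-ys)
                                                     (∑-fibres-≤ _≟₂_ κ₂ h κ₂! 0≤h-zs) ⟩
    ∑ h ys + ∑ h zs                      ∎
    where
    open ≤-Reasoning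
    c₁ : K₁ → ℚ
    c₁ k = ∑ h (fibre _≟₁_ κ₁ k ys)
    c₂ : K₂ → ℚ
    c₂ k = ∑ h (fibre _≟₂_ κ₂ k zs)
    charged : ∀ {x} → ∃ (λ y → (y ∈ ys × κ₁ y ≡ κ₁ x ⊎ y ∈ zs × κ₂ y ≡ κ₂ x) × h x ≤ h y) →
              h x ≤ c₁ (κ₁ x) + c₂ (κ₂ x)
    charged {x} (y , inj₁ (y∈ys , κ₁y≡κ₁x) , hx≤hy) = begin
      h x                    ≤⟨ hx≤hy ⟩
      h y                    ≤⟨ ∈-fibre⇒≤∑ _≟₁_ κ₁ h 0≤h-ys y∈ys κ₁y≡κ₁x ⟩
      c₁ (κ₁ x)              ≤⟨ p≤p+q (c₁ (κ₁ x)) (∑-fibre-nonNeg _≟₂_ κ₂ h 0≤h-zs (κ₂ x)) ⟩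
      c₁ (κ₁ x) + c₂ (κ₂ x)  ∎
    charged {x} (y , inj₂ (y∈zs , κ₂y≡κ₂x) , hx≤hy) = begin
      h x                    ≤⟨ hx≤hy ⟩
      h y                    ≤⟨ ∈-fibre⇒≤∑ _≟₂_ κ₂ h 0≤h-zs y∈zs κ₂y≡κ₂x ⟩
      c₂ (κ₂ x)              ≤⟨ p≤q+p (c₂ (κ₂ x)) (∑-fibre-nonNeg _≟₁_ κ₁ h 0≤h-ys (κ₁ x)) ⟩
      c₁ (κ₁ x) + c₂ (κ₂ x)  ∎

map⁺-injectiveOn : {A B : Set} {f : A → B} {xs : List A} → Unique xs →
                   (∀ {x y} → x ∈ xs → y ∈ xs → f x ≡ f y → x ≡ y) → Unique (map f xs)
map⁺-injectiveOn {xs = []}     []           _   = []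
map⁺-injectiveOn {xs = x ∷ xs} (x∉xs ∷ xs!) inj =
  All.map⁺ (All.tabulate (λ y∈xs → All.lookup x∉xs y∈xs ∘ inj (here refl) (there y∈xs)))
  ∷ map⁺-injectiveOn xs! (λ x∈xs y∈xs → inj (there x∈xs) (there y∈xs))

any⇒∃ : {A : Set} {p : A → Bool} (xs : List A) → any p xs ≡ true → ∃ λ x → x ∈ xs × T (p x)
any⇒∃ {p = p} xs any≡true = find (any⁻ p xs (Equivalence.from T-≡ any≡true))

module _ {n m : ℕ} where

  Adjacent : Fin n × Fin m → Fin n × Fin m → Set
  Adjacent e f = proj₁ e ≡ proj₁ f ⊎ proj₂ e ≡ proj₂ f

  -- Literally the test in the clause of greedy, so that `with accepts S M e` abstracts it.
  accepts : (Fin n → Bool) → List (Fin n × Fin m) → Fin n × Fin m → Bool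
  accepts S M (i , j) = S i ∧ not (any (λ e → ⌊ proj₁ e ≟ i ⌋) M) ∧ not (any (λ e → ⌊ proj₂ e ≟ j ⌋) M)

  rejected⇒adjacent : {S : Fin n → Bool} {M : List (Fin n × Fin m)} {e : Fin n × Fin m} →
                      S (proj₁ e) ≡ true → accepts S M e ≡ false → ∃ λ f → f ∈ M × Adjacent f e
  rejected⇒adjacent {S} {M} {i , j} Si rejected rewrite Si
    with any (λ e → ⌊ proj₁ e ≟ i ⌋) M in server-used | any (λ e → ⌊ proj₂ e ≟ j ⌋) M in job-used
  ... | true  | _    with f , f∈M , same-server ← any⇒∃ M server-used =
    f , f∈M , inj₁ (toWitness same-server)
  ... | false | true with f , f∈M , same-job ← any⇒∃ M job-used =
    f , f∈M , inj₂ (toWitness same-job)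

  greedy-⊆ : (S : Fin n → Bool) (M L : List (Fin n × Fin m)) → greedy S M L ⊆ M ++ L
  greedy-⊆ S M []      = xs⊆xs++ys M []
  greedy-⊆ S M (e ∷ L) with accepts S M e
  ... | true  = subst (greedy S (M ++ [ e ]) L ⊆_) (++-assoc M [ e ] L) (greedy-⊆ S (M ++ [ e ]) L)
  ... | false = ⊆-trans (greedy-⊆ S M L) (++⁺ʳ M (xs⊆x∷xs L e))

  greedy-⊇ : (S : Fin n → Bool) (M L : List (Fin n × Fin m)) → M ⊆ greedy S M L
  greedy-⊇ S M []      = ⊆-refl
  greedy-⊇ S M (e ∷ L) with accepts S M e
  ... | true  = ⊆-trans (xs⊆xs++ys M [ e ]) (greedy-⊇ S (M ++ [ e ]) L)
  ... | false = greedy-⊇ S M L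

  greedy-blocks : (w : Fin n × Fin m → ℚ) (S : Fin n → Bool) {M L : List (Fin n × Fin m)} →
                  AllPairs (λ e f → w f ≤ w e) L → (∀ {f e} → f ∈ M → e ∈ L → w e ≤ w f) →
                  ∀ {e} → e ∈ L → S (proj₁ e) ≡ true →
                  ∃ λ f → f ∈ greedy S M L × Adjacent f e × w e ≤ w f
  greedy-blocks w S {M} {e ∷ L} _ M≥L (here refl) Se with accepts S M e in accepted
  ... | true  = e , greedy-⊇ S (M ++ [ e ]) L (∈-++⁺ʳ M (here refl)) , inj₁ refl , ≤-refl
  ... | false with f , f∈M , adjacent ← rejected⇒adjacent {S} {M} Se accepted =
    f , greedy-⊇ S M L f∈M , adjacent , M≥L f∈M (here refl)
  greedy-blocks w S {M} {e′ ∷ L} (e′≥L ∷ L-sorted) M≥L (there e∈L) Se with accepts S M e′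
  ... | true  = greedy-blocks w S L-sorted M+e′≥L e∈L Se
    where
    M+e′≥L : ∀ {f e} → f ∈ M ++ [ e′ ] → e ∈ L → w e ≤ w f
    M+e′≥L f∈ e∈L with ∈-++⁻ M f∈
    ... | inj₁ f∈M         = M≥L f∈M (there e∈L)
    ... | inj₂ (here refl) = All.lookup e′≥L e∈L
  ... | false = greedy-blocks w S L-sorted (λ f∈M e∈L → M≥L f∈M (there e∈L)) e∈L Se

module _ {n T : ℕ} (I : Instance n T) where
  open Instance I

  weight : (t : Fin T) → Fin n × Fin (jobs t) → ℚ
  weight t (i , j) = w t i j

  restrict : {P : Fin n → Set} → Decidable P → EdgeSet I → EdgeSet I
  restrict P? F t = filter (P? ∘ proj₁) (F t)

  W-partition : {P : Fin n → Set} (P? : Decidable P) (F : EdgeSet I) →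
                W I F ≡ W I (restrict P? F) + W I (restrict (∁? P?) F)
  W-partition P? F =
    trans (∑-cong (allFin T) (λ {t} _ → ∑-filter-partition (P? ∘ proj₁) (weight t) (F t)))
          (∑-+ (λ t → Wt I t (restrict P? F t)) (λ t → Wt I t (restrict (∁? P?) F t)) (allFin T))

  W-restrict-≤ : {P : Fin n → Set} (P? : Decidable P) {F : EdgeSet I} →
                 (∀ t {e} → e ∈ F t → 0ℚ ≤ weight t e) → W I (restrict P? F) ≤ W I F
  W-restrict-≤ P? {F} 0≤w = ∑-mono (allFin T) (λ {t} _ → ∑-mono-⊑ (filter-⊆ (P? ∘ proj₁) (F t)) (0≤w t))

  W-restrict≡∑-load : {P : Fin n → Set} (P? : Decidable P) (F : EdgeSet I) →
                      W I (restrict P? F) ≡ ∑ (λ i → load I i F) (filter P? (allFin n))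
  W-restrict≡∑-load {P} P? F = begin
    ∑ (λ t → Wt I t (filter (P? ∘ proj₁) (F t))) (allFin T)
      ≡⟨ ∑-cong (allFin T) (λ {t} _ → cong (Wt I t)
           (filter-≐ (P? ∘ proj₁) (λ e → proj₁ e ∈? servers) (P≐∈servers {jobs t}) (F t))) ⟩
    ∑ (λ t → Wt I t (filter (λ e → proj₁ e ∈? servers) (F t))) (allFin T)
      ≡⟨ ∑-cong (allFin T) (λ {t} _ → sym (∑-fibres _≟_ proj₁ (weight t) servers! (F t))) ⟩
    ∑ (λ t → ∑ (λ i → Wt I t (atServer I i F t)) servers) (allFin T)
      ≡⟨ ∑-swap (λ t i → Wt I t (atServer I i F t)) (allFin T) servers ⟩
    ∑ (λ i → load I i F) servers ∎
    where
    open ≡-Reasoning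
    open import Data.List.Membership.DecPropositional _≟_ using (_∈?_)
    servers : List (Fin n)
    servers = filter P? (allFin n)
    servers! : Unique servers
    servers! = Unique.filter⁺ P? (Unique.allFin⁺ n)
    P≐∈servers : ∀ {m} → (λ (e : Fin n × Fin m) → P (proj₁ e)) ≐ (λ e → proj₁ e ∈ servers)
    P≐∈servers = ∈-filter⁺ P? (∈-allFin _) , proj₂ ∘ ∈-filter⁻ P? {xs = allFin n}

  module _ (t : Fin T) (e : Fin n × Fin (jobs t)) (F : EdgeSet I) where

    addAt-≡ : addAt I t e F t ≡ F t ++ [ e ]
    addAt-≡ with t ≟ t
    ... | yes refl = refl
    ... | no  t≢t  = contradiction refl t≢t

    addAt-≢ : ∀ {t′} → t ≢ t′ → addAt I t e F t′ ≡ F t′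
    addAt-≢ {t′} t≢t′ with t ≟ t′
    ... | yes refl = contradiction refl t≢t′
    ... | no  _    = refl

    load-addAt-≥ : (k : Fin n) → 0ℚ ≤ weight t e → load I k F ≤ load I k (addAt I t e F)
    load-addAt-≥ k 0≤we = ∑-mono (allFin T) grows
      where
      at-k : ∀ {t′} → Decidable (λ (e′ : Fin n × Fin (jobs t′)) → proj₁ e′ ≡ k)
      at-k e′ = proj₁ e′ ≟ k
      grows : ∀ {t′} → t′ ∈ allFin T → Wt I t′ (atServer I k F t′) ≤ Wt I t′ (atServer I k (addAt I t e F) t′)
      grows {t′} _ with t ≟ t′
      ... | no  _    = ≤-refl
      ... | yes refl = begin
        Wt I t (filter at-k (F t))                         ≤⟨ ∑-++-≥ (weight t) (filter at-k (F t)) 0≤w ⟩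
        Wt I t (filter at-k (F t) ++ filter at-k [ e ])    ≡⟨ cong (Wt I t) (sym (filter-++ at-k (F t) [ e ])) ⟩
        Wt I t (filter at-k (F t ++ [ e ]))                ∎
        where
        open ≤-Reasoning
        0≤w : ∀ {e′} → e′ ∈ filter at-k [ e ] → 0ℚ ≤ weight t e′
        0≤w e′∈ with here refl , _ ← ∈-filter⁻ at-k {xs = [ e ]} e′∈ = 0≤we

_⊆ᵇ_ : {n : ℕ} → (Fin n → Bool) → (Fin n → Bool) → Set
S ⊆ᵇ S′ = ∀ {i} → S i ≡ true → S′ i ≡ true

module Execution {n T : ℕ} (I : Instance n T) (σ : (t : Fin T) → List (Fin n × Fin (Instance.jobs I t)))
                 (v : Fin n → Bool) (σ-nonNeg : ∀ t {e} → e ∈ σ t → 0ℚ ≤ weight I t e) where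
  open Instance I

  ClosedOverHalf : State I → Set
  ClosedOverHalf st = ∀ i → State.S st i ≡ false → ½ * C i < load I i (State.B st)

  private
    -- The S-component of processEdge, abstracted over the decision so that it can be analysed
    -- without unfolding the local definition B′ of Defs.
    closeIf : {P : Set} → Dec P → Fin n → (Fin n → Bool) → Fin n → Bool
    closeIf d i S = if ⌊ d ⌋ then removeServer I i S else S

    closeIf-⊆ : {P : Set} (d : Dec P) (i : Fin n) (S : Fin n → Bool) → closeIf d i S ⊆ᵇ S
    closeIf-⊆ (no _)  i S Sk = Sk
    closeIf-⊆ (yes _) i S {k} Sk with k ≟ i
    ... | no _ = Sk

    closeIf-closed : {P : Set} (d : Dec P) (i : Fin n) (S : Fin n → Bool) {k : Fin n} →
                     closeIf d i S k ≡ false → S k ≡ false ⊎ (k ≡ i × P)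
    closeIf-closed (no _)  i S Sk≡false = inj₁ Sk≡false
    closeIf-closed (yes p) i S {k} Sk≡false with k ≟ i
    ... | yes k≡i = inj₂ (k≡i , p)
    ... | no  _   = inj₁ Sk≡false

  module _ (t : Fin T) where

    processEdges : State I → List (Fin n × Fin (jobs t)) → State I
    processEdges = foldl (processEdge I v t)

    private
      overHalf? : (st : State I) (e : Fin n × Fin (jobs t)) →
                  Dec (½ * C (proj₁ e) < load I (proj₁ e) (addAt I t e (State.B st)))
      overHalf? st e = ½ * C (proj₁ e) <? load I (proj₁ e) (addAt I t e (State.B st))

    processEdge-closedOverHalf : (st : State I) (e : Fin n × Fin (jobs t)) → 0ℚ ≤ weight I t e →
                                 ClosedOverHalf st → ClosedOverHalf (processEdge I v t st e)
    processEdge-closedOverHalf st e 0≤we overHalf k closed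
      with closeIf-closed (overHalf? st e) (proj₁ e) (State.S st) closed
    ... | inj₁ closed-before   = <-≤-trans (overHalf k closed-before) (load-addAt-≥ I t e (State.B st) k 0≤we)
    ... | inj₂ (refl , over½C) = over½C

    processEdges-closedOverHalf : (st : State I) (M : List (Fin n × Fin (jobs t))) →
                                  (∀ {e} → e ∈ M → 0ℚ ≤ weight I t e) →
                                  ClosedOverHalf st → ClosedOverHalf (processEdges st M)
    processEdges-closedOverHalf st []      0≤w overHalf = overHalf
    processEdges-closedOverHalf st (e ∷ M) 0≤w overHalf =
      processEdges-closedOverHalf _ M (0≤w ∘ there) (processEdge-closedOverHalf st e (0≤w (here refl)) overHalf)

    processEdges-S-⊆ : (st : State I) (M : List (Fin n × Fin (jobs t))) →
                       State.S (processEdges st M) ⊆ᵇ State.S st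
    processEdges-S-⊆ st []      = id
    processEdges-S-⊆ st (e ∷ M) = closeIf-⊆ (overHalf? st e) (proj₁ e) (State.S st) ∘ processEdges-S-⊆ _ M

    processEdges-B-≡ : (st : State I) (M : List (Fin n × Fin (jobs t))) →
                       State.B (processEdges st M) t ≡ State.B st t ++ M
    processEdges-B-≡ st []      = sym (++-identityʳ (State.B st t))
    processEdges-B-≡ st (e ∷ M) = begin
      State.B (processEdges (processEdge I v t st e) M) t  ≡⟨ processEdges-B-≡ _ M ⟩
      addAt I t e (State.B st) t ++ M                      ≡⟨ cong (_++ M) (addAt-≡ I t e (State.B st)) ⟩
      (State.B st t ++ [ e ]) ++ M                         ≡⟨ ++-assoc (State.B st t) [ e ] M ⟩
      State.B st t ++ e ∷ M                                ∎
      where open ≡-Reasoning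

    processEdges-B-≢ : ∀ {t′} → t ≢ t′ → (st : State I) (M : List (Fin n × Fin (jobs t))) →
                       State.B (processEdges st M) t′ ≡ State.B st t′
    processEdges-B-≢ t≢t′ st []      = refl
    processEdges-B-≢ t≢t′ st (e ∷ M) = trans (processEdges-B-≢ t≢t′ _ M) (addAt-≢ I t e (State.B st) t≢t′)

  steps-closedOverHalf : (ts : List (Fin T)) {st : State I} →
                         ClosedOverHalf st → ClosedOverHalf (foldl (step I σ v) st ts)
  steps-closedOverHalf []       overHalf = overHalf
  steps-closedOverHalf (t ∷ ts) {st} overHalf =
    steps-closedOverHalf ts (processEdges-closedOverHalf t st (greedy (State.S st) [] (σ t))
                                                         (σ-nonNeg t ∘ greedy-⊆ (State.S st) [] (σ t)) overHalf)

  GreedyOutputs : List (Fin T) → State I → Set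
  GreedyOutputs pending st =
    (∀ {t} → t ∈ pending → State.B st t ≡ []) ×
    (∀ {t} → t ∉ pending → ∃ λ S′ → State.S st ⊆ᵇ S′ × State.B st t ≡ greedy S′ [] (σ t))

  steps-greedyOutputs : {pending : List (Fin T)} → Unique pending → {st : State I} →
                        GreedyOutputs pending st → GreedyOutputs [] (foldl (step I σ v) st pending)
  steps-greedyOutputs []                                 outputs         = outputs
  steps-greedyOutputs {t ∷ pending} (t∉pending ∷ pending!) {st} (empty , done) =
    steps-greedyOutputs pending! (empty′ , done′)
    where
    M : List (Fin n × Fin (jobs t))
    M = greedy (State.S st) [] (σ t)
    st′ : State I
    st′ = processEdges t st M
    empty′ : ∀ {t′} → t′ ∈ pending → State.B st′ t′ ≡ []
    empty′ t′∈ = trans (processEdges-B-≢ t (All.lookup t∉pending t′∈) st M) (empty (there t′∈))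
    done′ : ∀ {t′} → t′ ∉ pending → ∃ λ S′ → State.S st′ ⊆ᵇ S′ × State.B st′ t′ ≡ greedy S′ [] (σ t′)
    done′ {t′} t′∉ with t ≟ t′
    ... | yes refl =
      State.S st , processEdges-S-⊆ t st M , trans (processEdges-B-≡ t st M) (cong (_++ M) (empty (here refl)))
    ... | no t≢t′ with S′ , S⊆S′ , B≡greedy ← done (λ { (here t′≡t) → t≢t′ (sym t′≡t) ; (there t′∈) → t′∉ t′∈ })
      = S′ , S⊆S′ ∘ processEdges-S-⊆ t st M , trans (processEdges-B-≢ t t≢t′ st M) B≡greedy

  run-closedOverHalf : ClosedOverHalf (run I σ v)
  run-closedOverHalf = steps-closedOverHalf (allFin T) (λ _ ())

  run-greedy : ∀ t → ∃ λ S′ → State.S (run I σ v) ⊆ᵇ S′ × State.B (run I σ v) t ≡ greedy S′ [] (σ t)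
  run-greedy t = proj₂ (steps-greedyOutputs (Unique.allFin⁺ T) ((λ _ → refl) , contradiction (∈-allFin _))) (λ ())

module Analysis {n T : ℕ} (I : Instance n T)
                (w-nonNeg : ∀ t i j → (i , j) ∈ Instance.E I t → 0ℚ ≤ Instance.w I t i j)
                (σ : (t : Fin T) → List (Fin n × Fin (Instance.jobs I t)))
                (scan : ∀ t → ScanOrder I t (σ t))
                (v : Fin n → Bool) where
  open Instance I

  σ-nonNeg : ∀ t {e} → e ∈ σ t → 0ℚ ≤ weight I t e
  σ-nonNeg t e∈σ = w-nonNeg t _ _ (∈-resp-↭ (proj₁ (scan t)) e∈σ)

  σ-sorted : ∀ t → AllPairs (λ e f → weight I t f ≤ weight I t e) (σ t)
  σ-sorted t = Linked⇒AllPairs (λ w₂≤w₁ w₃≤w₂ → ≤-trans w₃≤w₂ w₂≤w₁) (proj₂ (scan t))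

  open Execution I σ v σ-nonNeg

  S : Fin n → Bool
  S = State.S (run I σ v)

  B : EdgeSet I
  B = State.B (run I σ v)

  open? : Decidable (λ i → S i ≡ true)
  open? i = S i Bool.≟ true

  closed? : Decidable (λ i → S i ≢ true)
  closed? = ∁? open?

  B-nonNeg : ∀ t {e} → e ∈ B t → 0ℚ ≤ weight I t e
  B-nonNeg t e∈B with S′ , _ , B≡greedy ← run-greedy t =
    σ-nonNeg t (greedy-⊆ S′ [] (σ t) (subst (_ ∈_) B≡greedy e∈B))

  module _ {F : EdgeSet I} (feasible : Feasible I F) where

    private
      F⊆σ : ∀ t {e} → e ∈ F t → e ∈ σ t
      F⊆σ t = ∈-resp-↭ (↭-sym (proj₁ (scan t))) ∘ All.lookup (proj₁ feasible t)

      F-unique : ∀ t → Unique (F t)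
      F-unique = proj₁ (proj₂ feasible)

      F-matching : ∀ t → IsMatching I (F t)
      F-matching = proj₁ (proj₂ (proj₂ feasible))

      F-capacity : ∀ i → load I i F ≤ C i
      F-capacity = proj₂ (proj₂ (proj₂ feasible))

      keys-distinct : ∀ t {P : Fin n × Fin (jobs t) → Set} (P? : Decidable P) {K : Set}
                      {κ : Fin n × Fin (jobs t) → K} → (∀ {e f} → κ e ≡ κ f → Adjacent e f) →
                      Unique (map κ (filter P? (F t)))
      keys-distinct t P? κ-adjacent =
        map⁺-injectiveOn (Unique.filter⁺ P? (F-unique t))
          (λ e∈ f∈ → F-matching t (proj₁ (∈-filter⁻ P? e∈)) (proj₁ (∈-filter⁻ P? f∈)) ∘ κ-adjacent)

    open-edges-at : ∀ t → Wt I t (restrict I open? F t) ≤ Wt I t (restrict I open? B t) + Wt I t (B t)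
    open-edges-at t with S′ , open⊆S′ , B≡greedy ← run-greedy t =
      ∑-≤-by-charging _≟_ _≟_ proj₁ proj₂ (weight I t)
        (keys-distinct t open?ₑ inj₁) (keys-distinct t open?ₑ inj₂)
        (B-nonNeg t ∘ proj₁ ∘ ∈-filter⁻ open?ₑ) (B-nonNeg t) blocked
      where
      open?ₑ : Decidable (λ (e : Fin n × Fin (jobs t)) → S (proj₁ e) ≡ true)
      open?ₑ = open? ∘ proj₁
      blocked : ∀ {e} → e ∈ filter open?ₑ (F t) →
                ∃ λ f → (f ∈ filter open?ₑ (B t) × proj₁ f ≡ proj₁ e ⊎ f ∈ B t × proj₂ f ≡ proj₂ e)
                        × weight I t e ≤ weight I t f
      blocked {e} e∈ with e∈F , e-open ← ∈-filter⁻ open?ₑ e∈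
                 with f , f∈greedy , adjacent , we≤wf
                        ← greedy-blocks (weight I t) S′ (σ-sorted t) (λ ()) (F⊆σ t e∈F) (open⊆S′ e-open) =
        f , via adjacent (subst (f ∈_) (sym B≡greedy) f∈greedy) , we≤wf
        where
        via : Adjacent f e → f ∈ B t →
              f ∈ filter open?ₑ (B t) × proj₁ f ≡ proj₁ e ⊎ f ∈ B t × proj₂ f ≡ proj₂ e
        via (inj₁ same-server) f∈B =
          inj₁ (∈-filter⁺ open?ₑ f∈B (trans (cong S same-server) e-open) , same-server)
        via (inj₂ same-job)    f∈B = inj₂ (f∈B , same-job)

    open-edges-≤ : W I (restrict I open? F) ≤ W I (restrict I open? B) + W I B
    open-edges-≤ = begin
      W I (restrict I open? F)
        ≤⟨ ∑-mono (allFin T) (λ {t} _ → open-edges-at t) ⟩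
      ∑ (λ t → Wt I t (restrict I open? B t) + Wt I t (B t)) (allFin T)
        ≡⟨ ∑-+ (λ t → Wt I t (restrict I open? B t)) (λ t → Wt I t (B t)) (allFin T) ⟩
      W I (restrict I open? B) + W I B ∎
      where open ≤-Reasoning

    closed-edges-≤ : W I (restrict I closed? F) ≤ W I (restrict I closed? B) + W I (restrict I closed? B)
    closed-edges-≤ = begin
      W I (restrict I closed? F)
        ≡⟨ W-restrict≡∑-load I closed? F ⟩
      ∑ (load′ F) closed
        ≤⟨ ∑-mono closed (load-≤ ∘ proj₂ ∘ ∈-filter⁻ closed? {xs = allFin n}) ⟩
      ∑ (λ i → load′ B i + load′ B i) closed
        ≡⟨ ∑-+ (load′ B) (load′ B) closed ⟩
      ∑ (load′ B) closed + ∑ (load′ B) closed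
        ≡⟨ sym (cong₂ _+_ (W-restrict≡∑-load I closed? B) (W-restrict≡∑-load I closed? B)) ⟩
      W I (restrict I closed? B) + W I (restrict I closed? B) ∎
      where
      open ≤-Reasoning
      closed : List (Fin n)
      closed = filter closed? (allFin n)
      load′ : EdgeSet I → Fin n → ℚ
      load′ F′ i = load I i F′
      load-≤ : ∀ {i} → S i ≢ true → load I i F ≤ load I i B + load I i B
      load-≤ {i} ¬open = ≤-trans (F-capacity i) (½*p<q⇒p≤q+q (run-closedOverHalf i (¬-not ¬open)))

    W-feasible-≤ : W I F ≤ W I B + W I B + W I B
    W-feasible-≤ = begin
      W I F
        ≡⟨ W-partition I open? F ⟩
      W I (restrict I open? F) + W I (restrict I closed? F)
        ≤⟨ +-mono-≤ open-edges-≤ closed-edges-≤ ⟩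
      (Bₒ + W I B) + (B꜀ + B꜀)
        ≡⟨ solve 3 (λ x y z → (x :+ y) :+ (z :+ z) := y :+ (x :+ z) :+ z) refl Bₒ (W I B) B꜀ ⟩
      W I B + (Bₒ + B꜀) + B꜀
        ≡⟨ cong (λ x → W I B + x + B꜀) (sym (W-partition I open? B)) ⟩
      W I B + W I B + B꜀
        ≤⟨ +-monoʳ-≤ (W I B + W I B) (W-restrict-≤ I closed? B-nonNeg) ⟩
      W I B + W I B + W I B ∎
      where
      open ≤-Reasoning
      open +-*-Solver
      Bₒ B꜀ : ℚ
      Bₒ = W I (restrict I open? B)
      B꜀ = W I (restrict I closed? B)

lemma2 : ∀ {n T : ℕ} (I : Instance n T) → WellFormed I
         → (∀ t i j → (i , j) ∈ Instance.E I t → Instance.w I t i j ≤ Instance.C I i)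
         → (σ : (t : Fin T) → List (Fin n × Fin (Instance.jobs I t)))
         → (∀ t → ScanOrder I t (σ t))
         → (v : Fin n → Bool)
         → (Aopt : EdgeSet I) → Optimal I Aopt
         → (+ 1 / 3) * W I Aopt ≤ W I (State.B (run I σ v))
lemma2 I (_ , _ , w-nonNeg) _ σ scan v Aopt (feasible , _) = begin
  (+ 1 / 3) * W I Aopt                 ≤⟨ *-monoˡ-≤-nonNeg (+ 1 / 3) (W-feasible-≤ feasible) ⟩
  (+ 1 / 3) * (W I B + W I B + W I B)  ≡⟨ solve 1 (λ x → con (+ 1 / 3) :* (x :+ x :+ x) := x) refl (W I B) ⟩
  W I B                                ∎
  where
  open Analysis I w-nonNeg σ scan v
  open ≤-Reasoning
  open +-*-Solver
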